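{- Let $\mathcal{M}$ and $\mathcal{M}'$ be $c$-models, $s$ a state of $\mathcal{M}$ and $s'$ a state of $\mathcal{M}'$. If there is a $c$-bisimulation $Z$ between $\mathcal{M}$ and $\mathcal{M}'$ with $(s,s')\in Z$, then for all $\phi\in\mathcal{L}_\Delta$, $\mathcal{M},s\Vvdash\phi$ iff $\mathcal{M}',s'\Vvdash\phi$.
   Context: $\mathcal{L}_\Delta$: $\phi::=p\mid\neg\phi\mid(\phi\land\phi)\mid\Delta\phi$, $p$ in a countable set $\mathbf{Prop}$. A neighborhood model is $\langle S,N,V\rangle$, $S\neq\emptyset$, $N:S\to 2^{2^S}$, $V:\mathbf{Prop}\to 2^S$; a $c$-model additionally satisfies: $X\in N(s)$ implies $S\setminus X\in N(s)$. Semantics $\Vvdash$: $s\Vvdash p$ iff $s\in V(p)$, Boolean clauses standard, $\mathcal{M},s\Vvdash\Delta\phi$ iff $\{t:\mathcal{M},t\Vvdash\phi\}\in N(s)$. For $Z\subseteq S\times S'$, $(U,U')$ is $Z$-coherent if for all $(x,y)\in Z$, $x\in U$ iff $y\in U'$. A $c$-bisimulation between $c$-models $\langle S,N,V\rangle$, $\langle S',N',V'\rangle$ is a nonempty $Z\subseteq S\times S'$ such that for all $(s,s')\in Z$: $s\in V(p)$ iff $s'\in V'(p)$ for all $p$, and for every $Z$-coherent $(U,U')$, $U\in N(s)$ iff $U'\in N'(s')$. -}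

module Defs where

open import Level using (0ℓ; suc)
open import Data.Nat using (ℕ)
open import Data.Product using (Σ; _×_; ∃)
open import Relation.Nullary using (¬_)
open import Relation.Unary using (Pred; ∁)
open import Function.Bundles using (_⇔_)

Prop : Set
Prop = ℕ

data Form : Set where
  var : Prop → Form
  ¬'_ : Form → Form
  _∧'_ : Form → Form → Form
  Δ : Form → Form

record NbhdModel : Set₁ where
  field
    S : Set
    inhabited : S
    N : S → Pred (Pred S 0ℓ) 0ℓ
    V : Prop → Pred S 0ℓ

record CModel : Set₁ where
  field
    model : NbhdModel
  open NbhdModel model public
  field
    c-closed : ∀ (s : S) (X : Pred S 0ℓ) → N s X → N s (∁ X)

module _ (M : NbhdModel) where
  open NbhdModel M
  _⊩_ : S → Form → Set
  s ⊩ var p = V p s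
  s ⊩ (¬' φ) = ¬ (s ⊩ φ)
  s ⊩ (φ ∧' ψ) = (s ⊩ φ) × (s ⊩ ψ)
  s ⊩ Δ φ = N s (λ t → t ⊩ φ)

Sat : (M : NbhdModel) → NbhdModel.S M → Form → Set
Sat M s φ = _⊩_ M s φ

Coherent : {S S' : Set} → (S → S' → Set) → Pred S 0ℓ → Pred S' 0ℓ → Set
Coherent {S} {S'} Z U U' = ∀ (x : S) (y : S') → Z x y → (U x ⇔ U' y)

record CBisim (M M' : CModel) (Z : CModel.S M → CModel.S M' → Set) : Set₁ where
  private
    module M = CModel M
    module M' = CModel M'
  field
    nonempty : Σ M.S λ s → Σ M'.S λ s' → Z s s'
    atoms : ∀ {s s'} → Z s s' → ∀ (p : Prop) → (M.V p s ⇔ M'.V p s')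
    nbhd : ∀ {s s'} → Z s s' → ∀ (U : Pred M.S 0ℓ) (U' : Pred M'.S 0ℓ) →
           Coherent Z U U' → (M.N s U ⇔ M'.N s' U')

-- The Boolean cases are congruences; for Δφ the induction
-- hypothesis says precisely that the truth sets of φ in the two models are
-- Z-coherent, so the neighbourhood clause of the bisimulation applies.
module Submission where

open import Defs
open import Level using (0ℓ)
open import Relation.Unary using (Pred)
open import Function.Bundles using (_⇔_)
open import Function.Related.TypeIsomorphisms using (¬-cong-⇔)
open import Data.Product.Function.NonDependent.Propositional using (_×-⇔_)

module Invariance (M M' : NbhdModel) (Z : NbhdModel.S M → NbhdModel.S M' → Set) where
  private
    module M = NbhdModel M
    module M' = NbhdModel M'

  truthSet : (K : NbhdModel) → Form → Pred (NbhdModel.S K) 0ℓ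
  truthSet K φ t = Sat K t φ

  module _
    (atoms : ∀ {s s'} → Z s s' → ∀ p → M.V p s ⇔ M'.V p s')
    (nbhd : ∀ {s s'} → Z s s' → ∀ U U' → Coherent Z U U' → M.N s U ⇔ M'.N s' U')
    where

    sat-invariant : ∀ {s s'} → Z s s' → ∀ φ → Sat M s φ ⇔ Sat M' s' φ
    sat-invariant z (var p) = atoms z p
    sat-invariant z (¬' φ) = ¬-cong-⇔ (sat-invariant z φ)
    sat-invariant z (φ ∧' ψ) = sat-invariant z φ ×-⇔ sat-invariant z ψ
    sat-invariant z (Δ φ) = nbhd z (truthSet M φ) (truthSet M' φ) truthSets-coherent
      where
      truthSets-coherent : Coherent Z (truthSet M φ) (truthSet M' φ)
      truthSets-coherent x y zxy = sat-invariant zxy φ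

proposition4 : (M M' : CModel) (s : CModel.S M) (s' : CModel.S M')
    → (Z : CModel.S M → CModel.S M' → Set)
    → CBisim M M' Z → Z s s'
    → (φ : Form) → Sat (CModel.model M) s φ ⇔ Sat (CModel.model M') s' φ
proposition4 M M' s s' Z B =
  Invariance.sat-invariant (CModel.model M) (CModel.model M') Z (CBisim.atoms B) (CBisim.nbhd B)
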